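{- Let $(P_C)=\{(s_1,t_1),\dots,(s_k,t_k)\}$ be an $E$-unification problem with simple variable restriction, whose terms have variables among $X\cup C$ with $X$, $C$ finite and disjoint, and let $\mathcal{A}=\mathbf{F}(X\cup C)/\theta$, where $\theta$ is the congruence generated by the pairs $(s_i,t_i)$. Then the antisymmetric quotients of the preordered set of algebraic $C$-unifiers of $(\mathcal{A},C)$ and of the preordered set of symbolic $C$-unifiers of $(P_C)$, each preordered by the relation "is less general than", are isomorphic.
   Context: $E$ is an equational theory in a functional signature $\mathcal{L}$ containing at least one constant symbol; $=_E$ means equality provable from $E$; $\mathbf{F}(Y)$ is the free $E$-algebra on a finite set $Y$, and $+$ denotes coproduct of finitely presented $E$-algebras (so $\mathbf{F}(X\cup C)\cong\mathbf{F}(X)+\mathbf{F}(C)$). Symbolic side: a substitution $\sigma$ with domain the formulas in variables $X\cup C$ is $C$-invariant if $\sigma(c)=c$ for $c\in C$ and $\sigma(x)$ contains no variable of $C$ for $x\notin C$; it is a $C$-unifier of $(P_C)$ if it is $C$-invariant and $\sigma(s_i)=_E\sigma(t_i)$ for all $i$. A substitution $\tau$ into $Fm(\overline q)$ is less general than $\sigma$ into $Fm(\overline q')$ (same domain) if there is a substitution $\theta:Fm(\overline q')\to Fm(\overline q)$ with $\tau(v)=_E\theta(\sigma(v))$ for every variable $v$ of the domain. Algebraic side: a $C$-unifier of $(\mathcal{A},C)$ is a homomorphism $\sigma:\mathbf{F}(X)\to\mathbf{F}(Z)$, $Z$ finite, such that $\sigma+1_{\mathbf{F}(C)}:\mathbf{F}(X)+\mathbf{F}(C)\to\mathbf{F}(Z)+\mathbf{F}(C)$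 factors through the quotient map $\mathbf{F}(X)+\mathbf{F}(C)\to\mathcal{A}$ (equivalently, in the opposite category of finitely presented $E$-algebras, $\sigma^*\times 1$ factors through the regular subobject $\mathcal{A}^*\hookrightarrow\mathbf{F}(X)^*\times\mathbf{F}(C)^*$). For algebraic $C$-unifiers $\sigma:\mathbf{F}(X)\to\mathbf{F}(Z)$ and $\gamma:\mathbf{F}(X)\to\mathbf{F}(W)$, $\gamma$ is less general than $\sigma$ if there is a homomorphism $k:\mathbf{F}(Z)\to\mathbf{F}(W)$ with $k\circ\sigma=\gamma$. -}

module Defs where

open import Level using (0ℓ)
open import Data.Nat using (ℕ)
open import Data.Fin using (Fin)
open import Data.Sum using (_⊎_; inj₁; inj₂)
open import Data.Product using (Σ; Σ-syntax; _×_; _,_)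
open import Data.Empty using (⊥)
open import Relation.Binary.PropositionalEquality using (_≡_)
open import Relation.Nullary using (¬_)

record Signature : Set₁ where
  field
    Op    : Set
    arity : Op → ℕ
open Signature public

HasConstant : Signature → Set
HasConstant S = Σ[ f ∈ Op S ] arity S f ≡ 0

data Tm (S : Signature) (V : Set) : Set where
  var : V → Tm S V
  op  : (f : Op S) → (Fin (arity S f) → Tm S V) → Tm S V

sub : ∀ {S V W} → (V → Tm S W) → Tm S V → Tm S W
sub s (var v)   = s v
sub s (op f ts) = op f (λ i → sub s (ts i))

rename : ∀ {S V W} → (V → W) → Tm S V → Tm S W
rename r = sub (λ v → var (r v))

data Occurs {S : Signature} {V : Set} (v : V) : Tm S V → Set where
  here  : Occurs v (var v)
  under : ∀ f ts i → Occurs v (ts i) → Occurs v (op f ts)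

record EqTheory (S : Signature) : Set₁ where
  field
    Ax  : Set
    lhs : Ax → Tm S ℕ
    rhs : Ax → Tm S ℕ
open EqTheory public

-- derivability from E together with extra (non-substitutable) hypotheses H
-- on terms over V: the least congruence on Tm V containing all
-- substitution instances of the axioms of E and the pairs in H.
data Deriv {S : Signature} (E : EqTheory S) {V : Set}
           (H : Tm S V → Tm S V → Set) : Tm S V → Tm S V → Set where
  d-refl  : ∀ {t} → Deriv E H t t
  d-sym   : ∀ {t u} → Deriv E H t u → Deriv E H u t
  d-trans : ∀ {t u w} → Deriv E H t u → Deriv E H u w → Deriv E H t w
  d-cong  : ∀ f {ts us} → (∀ i → Deriv E H (ts i) (us i))
            → Deriv E H (op f ts) (op f us)
  d-ax    : ∀ a (ρ : ℕ → Tm S V) → Deriv E H (sub ρ (lhs E a)) (sub ρ (rhs E a))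
  d-hyp   : ∀ {t u} → H t u → Deriv E H t u

NoHyp : ∀ {S V} → Tm S V → Tm S V → Set
NoHyp _ _ = ⊥

_⊢_≈_ : ∀ {S V} → EqTheory S → Tm S V → Tm S V → Set
E ⊢ t ≈ u = Deriv E NoHyp t u

module _ {S : Signature} (E : EqTheory S) where

  sub-sub : ∀ {U V W} (s : V → Tm S W) (ρ : U → Tm S V) (t : Tm S U)
          → E ⊢ sub s (sub ρ t) ≈ sub (λ u → sub s (ρ u)) t
  sub-sub s ρ (var u)   = d-refl
  sub-sub s ρ (op f ts) = d-cong f (λ i → sub-sub s ρ (ts i))

  sub-cong : ∀ {V W} (s : V → Tm S W) {t u : Tm S V}
           → E ⊢ t ≈ u → E ⊢ sub s t ≈ sub s u
  sub-cong s d-refl          = d-refl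
  sub-cong s (d-sym d)       = d-sym (sub-cong s d)
  sub-cong s (d-trans d d')  = d-trans (sub-cong s d) (sub-cong s d')
  sub-cong s (d-cong f ds)   = d-cong f (λ i → sub-cong s (ds i))
  sub-cong s (d-ax a ρ)      =
    d-trans (sub-sub s ρ (lhs E a))
      (d-trans (d-ax a (λ u → sub s (ρ u))) (d-sym (sub-sub s ρ (rhs E a))))
  sub-cong s (d-hyp ())

record Alg (S : Signature) : Set₁ where
  field
    Carrier : Set
    _≈_     : Carrier → Carrier → Set
    ≈-refl  : ∀ {x} → x ≈ x
    ≈-sym   : ∀ {x y} → x ≈ y → y ≈ x
    ≈-trans : ∀ {x y z} → x ≈ y → y ≈ z → x ≈ z
    ⟦_⟧     : (f : Op S) → (Fin (arity S f) → Carrier) → Carrier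
    ⟦⟧-cong : ∀ f {xs ys} → (∀ i → xs i ≈ ys i) → ⟦ f ⟧ xs ≈ ⟦ f ⟧ ys

record Hom {S : Signature} (A B : Alg S) : Set where
  private
    module A = Alg A
    module B = Alg B
  field
    fun     : A.Carrier → B.Carrier
    fun-cong : ∀ {x y} → x A.≈ y → fun x B.≈ fun y
    fun-op  : ∀ f xs → fun (A.⟦ f ⟧ xs) B.≈ B.⟦ f ⟧ (λ i → fun (xs i))
open Hom public

_∘H_ : ∀ {S} {A B D : Alg S} → Hom B D → Hom A B → Hom A D
_∘H_ {D = D} g h = record
  { fun      = λ x → fun g (fun h x)
  ; fun-cong = λ e → fun-cong g (fun-cong h e)
  ; fun-op   = λ f xs → Alg.≈-trans D (fun-cong g (fun-op h f xs)) (fun-op g f _)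
  }

_≈H_ : ∀ {S} {A B : Alg S} → Hom A B → Hom A B → Set
_≈H_ {A = A} {B} g h = ∀ x → Alg._≈_ B (fun g x) (fun h x)

QuotAlg : ∀ {S} → EqTheory S → (V : Set) → (Tm S V → Tm S V → Set) → Alg S
QuotAlg {S} E V H = record
  { Carrier = Tm S V
  ; _≈_     = Deriv E H
  ; ≈-refl  = d-refl
  ; ≈-sym   = d-sym
  ; ≈-trans = d-trans
  ; ⟦_⟧     = op
  ; ⟦⟧-cong = d-cong
  }

F : ∀ {S} → EqTheory S → Set → Alg S
F E Y = QuotAlg E Y NoHyp

-- The setting of Proposition 3.5
--   X = Fin n (unrestricted variables), C = Fin m (restricted variables),
--   X ∪ C = Fin n ⊎ Fin m (disjoint), the problem (P_C) consists of the
--   k pairs (s i , t i).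

module CUnification {S : Signature} (E : EqTheory S) (n m k : ℕ)
                    (s t : Fin k → Tm S (Fin n ⊎ Fin m)) where

  X C : Set
  X = Fin n
  C = Fin m

  data Pairs : Tm S (X ⊎ C) → Tm S (X ⊎ C) → Set where
    pair : ∀ i → Pairs (s i) (t i)

  𝒜 : Alg S
  𝒜 = QuotAlg E (X ⊎ C) Pairs

  quot : Hom (F E (X ⊎ C)) 𝒜
  quot = record
    { fun      = λ u → u
    ; fun-cong = λ e → lift e
    ; fun-op   = λ f xs → d-refl
    }
    where
      lift : ∀ {u w} → E ⊢ u ≈ w → Deriv E Pairs u w
      lift d-refl          = d-refl
      lift (d-sym d)       = d-sym (lift d)
      lift (d-trans d d')  = d-trans (lift d) (lift d')
      lift (d-cong f ds)   = d-cong f (λ i → lift (ds i))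
      lift (d-ax a ρ)      = d-ax a ρ
      lift (d-hyp ())

  -- σ + 1_{F(C)} : F(X)+F(C) → F(Z)+F(C), with F(Y)+F(C) = F(Y ⊎ C);
  -- the unique homomorphism sending ι₁ x to ι₁(σ x) and ι₂ c to ι₂ c.
  _+1 : ∀ {Z : Set} → Hom (F E X) (F E Z) → Hom (F E (X ⊎ C)) (F E (Z ⊎ C))
  _+1 {Z} σ = record
    { fun      = sub val
    ; fun-cong = sub-cong E val
    ; fun-op   = λ f xs → d-refl
    }
    where
      val : X ⊎ C → Tm S (Z ⊎ C)
      val (inj₁ x) = rename inj₁ (fun σ (var x))
      val (inj₂ c) = var (inj₂ c)

  record AlgCUnifier : Set where
    field
      zsize  : ℕ                          -- Z = Fin zsize
      σ      : Hom (F E X) (F E (Fin zsize))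
      factor : Σ[ h ∈ Hom 𝒜 (F E (Fin zsize ⊎ C)) ] (h ∘H quot) ≈H (σ +1)
  open AlgCUnifier public

  _≤Alg_ : AlgCUnifier → AlgCUnifier → Set
  γ ≤Alg σ' = Σ[ κ ∈ Hom (F E (Fin (zsize σ'))) (F E (Fin (zsize γ))) ]
                 (κ ∘H σ σ') ≈H σ γ

  -- Symbolic side
  -- A codomain variable set q̄ ⊇ C is represented as Fin q ⊎ C.

  record SymCUnifier : Set where
    field
      qsize : ℕ
      τ     : X ⊎ C → Tm S (Fin qsize ⊎ C)
      fixC  : ∀ c → τ (inj₂ c) ≡ var (inj₂ c)
      noC   : ∀ x c → ¬ Occurs (inj₂ c) (τ (inj₁ x))
      unif  : ∀ i → E ⊢ sub τ (s i) ≈ sub τ (t i)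
  open SymCUnifier public

  _≤Sym_ : SymCUnifier → SymCUnifier → Set
  ρ ≤Sym τ' = Σ[ θ ∈ (Fin (qsize τ') ⊎ C → Tm S (Fin (qsize ρ) ⊎ C)) ]
                 (∀ v → E ⊢ τ ρ v ≈ sub θ (τ τ' v))

-- Monotone maps in both directions that are mutually inverse up to the
-- equivalence x ~ y ⇔ (x ≤ y × y ≤ x); this is exactly an order
-- isomorphism between the posets of ~-classes.

record AntisymQuotientIso {A B : Set} (_≤A_ : A → A → Set)
                          (_≤B_ : B → B → Set) : Set where
  field
    to        : A → B
    from      : B → A
    to-mono   : ∀ {a a'} → a ≤A a' → to a ≤B to a'
    from-mono : ∀ {b b'} → b ≤B b' → from b ≤A from b'
    from-to   : ∀ a → (from (to a) ≤A a) × (a ≤A from (to a))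
    to-from   : ∀ b → (to (from b) ≤B b) × (b ≤B to (from b))

module Submission where

open import Defs
open import Data.Nat using (ℕ)
open import Data.Fin using (Fin)
open import Data.Sum using (_⊎_; inj₁; inj₂)
open import Data.Fin.Properties using (¬Fin0)
open import Data.Product using (_,_; proj₁; proj₂)
open import Data.Empty using (⊥-elim)
open import Function using (_∘_)
open import Relation.Binary.PropositionalEquality using (refl; subst)
open import Relation.Nullary using (¬_)

-- A homomorphism F(X) → F(Z) is the same thing as a substitution X → Tm Z,
-- and σ + 1 is the C-invariant substitution that extends it by the identity
-- on C.  Conversely a C-invariant substitution sends X to terms without
-- variables from C, which are terms over the codomain variables alone; it is
-- a C-unifier exactly when it respects the generating pairs of θ, i.e. when
-- it factors through 𝒜.  Both translations preserve "less general than" and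
-- are mutually inverse up to E-equality.

module Substitution {S : Signature} (E : EqTheory S) where

  sub-ext : ∀ {V W} (f g : V → Tm S W) (u : Tm S V)
          → (∀ v → E ⊢ f v ≈ g v) → E ⊢ sub f u ≈ sub g u
  sub-ext f g (var v)   f≈g = f≈g v
  sub-ext f g (op o ts) f≈g = d-cong o (λ i → sub-ext f g (ts i) f≈g)

  sub-var : ∀ {V} (u : Tm S V) → E ⊢ sub var u ≈ u
  sub-var (var v)   = d-refl
  sub-var (op f ts) = d-cong f (λ i → sub-var (ts i))

  sub-rename : ∀ {U V W} (f : V → Tm S W) (r : U → V) (u : Tm S U)
             → E ⊢ sub f (rename r u) ≈ sub (f ∘ r) u
  sub-rename f r (var a)   = d-refl
  sub-rename f r (op o ts) = d-cong o (λ i → sub-rename f r (ts i))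

  sub-respects-hyps : ∀ {V W} {H : Tm S V → Tm S V → Set} (f : V → Tm S W)
                    → (∀ {u w} → H u w → E ⊢ sub f u ≈ sub f w)
                    → ∀ {u w} → Deriv E H u w → E ⊢ sub f u ≈ sub f w
  sub-respects-hyps f resp d-refl          = d-refl
  sub-respects-hyps f resp (d-sym d)       = d-sym (sub-respects-hyps f resp d)
  sub-respects-hyps f resp (d-trans d d')  =
    d-trans (sub-respects-hyps f resp d) (sub-respects-hyps f resp d')
  sub-respects-hyps f resp (d-cong o ds)   = d-cong o (λ i → sub-respects-hyps f resp (ds i))
  sub-respects-hyps f resp (d-ax a ρ)      = sub-cong E f (d-ax a ρ)
  sub-respects-hyps f resp (d-hyp h)       = resp h

  subHom : ∀ {V W} → (V → Tm S W) → Hom (F E V) (F E W)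
  subHom f = record { fun = sub f ; fun-cong = sub-cong E f ; fun-op = λ _ _ → d-refl }

  idHom : ∀ {V} → Hom (F E V) (F E V)
  idHom = record { fun = λ u → u ; fun-cong = λ e → e ; fun-op = λ _ _ → d-refl }

  hom≈sub : ∀ {V W} (h : Hom (F E V) (F E W)) (u : Tm S V)
          → E ⊢ fun h u ≈ sub (λ v → fun h (var v)) u
  hom≈sub h (var v)   = d-refl
  hom≈sub h (op f ts) = d-trans (fun-op h f ts) (d-cong f (λ i → hom≈sub h (ts i)))

  hom-ext : ∀ {V W} (g h : Hom (F E V) (F E W))
          → (∀ v → E ⊢ fun g (var v) ≈ fun h (var v)) → g ≈H h
  hom-ext g h g≈h u =
    d-trans (hom≈sub g u) (d-trans (sub-ext _ _ u g≈h) (d-sym (hom≈sub h u)))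

  _+id : ∀ {V W C : Set} → (V → Tm S W) → V ⊎ C → Tm S (W ⊎ C)
  (f +id) (inj₁ v) = rename inj₁ (f v)
  (f +id) (inj₂ c) = var (inj₂ c)

  sub-+id-rename-inj₁ : ∀ {V W C : Set} (f : V → Tm S W) (u : Tm S V)
                      → E ⊢ sub (_+id {C = C} f) (rename inj₁ u) ≈ rename inj₁ (sub f u)
  sub-+id-rename-inj₁ f u =
    d-trans (sub-rename (f +id) inj₁ u) (d-sym (sub-sub E _ f u))

  rename-inj₁-¬Occurs-inj₂ : ∀ {V C : Set} (u : Tm S V) (c : C)
                           → ¬ Occurs (inj₂ c) (rename {W = V ⊎ C} inj₁ u)
  rename-inj₁-¬Occurs-inj₂ (var a)   c ()
  rename-inj₁-¬Occurs-inj₂ (op f ts) c (under _ _ i o) = rename-inj₁-¬Occurs-inj₂ (ts i) c o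

-- The constant makes "drop the variables of C" a total map on terms; it is
-- only ever applied to terms in which no variable of C occurs.
module Erasure {S : Signature} (hc : HasConstant S) (E : EqTheory S) where
  open Substitution E

  constant : ∀ {V} → Tm S V
  constant = op (proj₁ hc) (λ i → ⊥-elim (¬Fin0 (subst Fin (proj₂ hc) i)))

  eraseᵣ : ∀ {V C : Set} → V ⊎ C → Tm S V
  eraseᵣ (inj₁ v) = var v
  eraseᵣ (inj₂ c) = constant

  erase : ∀ {V C : Set} → Tm S (V ⊎ C) → Tm S V
  erase = sub eraseᵣ

  erase-rename-inj₁ : ∀ {V C : Set} (u : Tm S V) → E ⊢ erase {C = C} (rename inj₁ u) ≈ u
  erase-rename-inj₁ u = d-trans (sub-rename eraseᵣ inj₁ u) (sub-var u)

  rename-inj₁-erase : ∀ {V C : Set} (u : Tm S (V ⊎ C))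
                    → (∀ c → ¬ Occurs (inj₂ c) u) → E ⊢ rename inj₁ (erase u) ≈ u
  rename-inj₁-erase (var (inj₁ v)) noC = d-refl
  rename-inj₁-erase (var (inj₂ c)) noC = ⊥-elim (noC c here)
  rename-inj₁-erase (op f ts)      noC =
    d-cong f (λ i → rename-inj₁-erase (ts i) (λ c o → noC c (under f ts i o)))

  erase-sub-rename-inj₁ : ∀ {U V C : Set} (f : U ⊎ C → Tm S (V ⊎ C)) (u : Tm S U)
                        → E ⊢ erase (sub f (rename inj₁ u)) ≈ sub (erase ∘ f ∘ inj₁) u
  erase-sub-rename-inj₁ f u =
    d-trans (sub-sub E eraseᵣ f (rename inj₁ u)) (sub-rename (erase ∘ f) inj₁ u)

module Correspondence {S : Signature} (hc : HasConstant S) (E : EqTheory S) (n m k : ℕ)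
                      (s t : Fin k → Tm S (Fin n ⊎ Fin m)) where
  open CUnification E n m k s t
  open Substitution E
  open Erasure hc E

  onVars : ∀ {V W} → Hom (F E V) (F E W) → V → Tm S W
  onVars h v = fun h (var v)

  +1≈sub-+id : ∀ {Z} (σ : Hom (F E X) (F E Z)) (u : Tm S (X ⊎ C))
             → E ⊢ fun (σ +1) u ≈ sub (onVars σ +id) u
  +1≈sub-+id σ u = sub-ext _ _ u λ { (inj₁ x) → d-refl ; (inj₂ c) → d-refl }

  toSym : AlgCUnifier → SymCUnifier
  toSym a = record
    { qsize = zsize a
    ; τ     = onVars (σ a) +id
    ; fixC  = λ c → refl
    ; noC   = λ x → rename-inj₁-¬Occurs-inj₂ (onVars (σ a) x)
    ; unif  = λ i → d-trans (d-sym (factors (s i)))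
                      (d-trans (fun-cong h (d-hyp (pair i))) (factors (t i)))
    }
    where
      h : Hom 𝒜 (F E (Fin (zsize a) ⊎ C))
      h = proj₁ (factor a)
      factors : ∀ u → E ⊢ fun h u ≈ sub (onVars (σ a) +id) u
      factors u = d-trans (proj₂ (factor a) u) (+1≈sub-+id (σ a) u)

  fromSym : SymCUnifier → AlgCUnifier
  fromSym b = record
    { zsize  = qsize b
    ; σ      = σb
    ; factor = hb , λ u → d-trans (sub-ext (τ b) _ u τ≈) (d-sym (+1≈sub-+id σb u))
    }
    where
      σb : Hom (F E X) (F E (Fin (qsize b)))
      σb = subHom (erase ∘ τ b ∘ inj₁)
      hb : Hom 𝒜 (F E (Fin (qsize b) ⊎ C))
      hb = record { fun = sub (τ b)
                  ; fun-cong = sub-respects-hyps (τ b) λ { (pair i) → unif b i }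
                  ; fun-op = λ _ _ → d-refl }
      τ≈ : ∀ v → E ⊢ τ b v ≈ (onVars σb +id) v
      τ≈ (inj₁ x) = d-sym (rename-inj₁-erase (τ b (inj₁ x)) (noC b x))
      τ≈ (inj₂ c) rewrite fixC b c = d-refl

  toSym-mono : ∀ {γ σ'} → γ ≤Alg σ' → toSym γ ≤Sym toSym σ'
  toSym-mono {γ} {σ'} (κ , κσ'≈σγ) = onVars κ +id , pointwise
    where
      pointwise : ∀ v → E ⊢ τ (toSym γ) v ≈ sub (onVars κ +id) (τ (toSym σ') v)
      pointwise (inj₂ c) = d-refl
      pointwise (inj₁ x) = d-sym (d-trans (sub-+id-rename-inj₁ (onVars κ) w)
        (sub-cong E _ (d-trans (d-sym (hom≈sub κ w)) (κσ'≈σγ (var x)))))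
        where
          w : Tm S (Fin (zsize σ'))
          w = onVars (σ σ') x

  fromSym-mono : ∀ {ρ τ'} → ρ ≤Sym τ' → fromSym ρ ≤Alg fromSym τ'
  fromSym-mono {ρ} {τ'} (θ , ρ≈θτ') = subHom (erase ∘ θ ∘ inj₁) , λ u →
      d-trans (sub-sub E _ _ u) (sub-ext _ _ u pointwise)
    where
      -- τ' x is C-free, so it is the inj₁-renaming of its erasure
      pointwise : ∀ x → E ⊢ sub (erase ∘ θ ∘ inj₁) (erase (τ τ' (inj₁ x)))
                              ≈ erase (τ ρ (inj₁ x))
      pointwise x = d-sym (d-trans (sub-cong E eraseᵣ (ρ≈θτ' (inj₁ x)))
        (d-trans (sub-cong E eraseᵣ (sub-cong E θ (d-sym (rename-inj₁-erase w (noC τ' x)))))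
                 (erase-sub-rename-inj₁ θ (erase w))))
        where
          w : Tm S (Fin (qsize τ') ⊎ C)
          w = τ τ' (inj₁ x)

  fromSym∘toSym : ∀ a → σ (fromSym (toSym a)) ≈H σ a
  fromSym∘toSym a = hom-ext (σ (fromSym (toSym a))) (σ a) λ x →
    erase-rename-inj₁ {C = C} (onVars (σ a) x)

  toSym∘fromSym : ∀ b v → E ⊢ τ (toSym (fromSym b)) v ≈ τ b v
  toSym∘fromSym b (inj₁ x) = rename-inj₁-erase (τ b (inj₁ x)) (noC b x)
  toSym∘fromSym b (inj₂ c) rewrite fixC b c = d-refl

  iso : AntisymQuotientIso _≤Alg_ _≤Sym_
  iso = record
    { to        = toSym
    ; from      = fromSym
    ; to-mono   = λ {γ} {σ'} → toSym-mono {γ} {σ'}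
    ; from-mono = λ {ρ} {τ'} → fromSym-mono {ρ} {τ'}
    ; from-to   = λ a → (idHom , λ u → d-sym (fromSym∘toSym a u))
                      , (idHom , fromSym∘toSym a)
    ; to-from   = λ b → (var , λ v → d-trans (toSym∘fromSym b v) (d-sym (sub-var (τ b v))))
                      , (var , λ v → d-trans (d-sym (toSym∘fromSym b v)) (d-sym (sub-var _)))
    }

proposition3p5 : (S : Signature) → HasConstant S → (E : EqTheory S)
    → (n m k : ℕ) → (s t : Fin k → Tm S (Fin n ⊎ Fin m))
    → AntisymQuotientIso (CUnification._≤Alg_ E n m k s t)
                         (CUnification._≤Sym_ E n m k s t)
proposition3p5 S hc E n m k s t = Correspondence.iso hc E n m k s t
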